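{- Let $I=([\ell_v,r_v])_{v\in V}$ and $I'=([\ell'_{v},r'_{v}])_{v\in V'}$ be two consistent interval graphs. Then there is an interval graph $J$ on vertex set $V\cup V'$ that is consistent with both $I$ and $I'$. In particular, any edge in $E(J)\setminus(E(I)\cup E(I'))$ has one endvertex in $V\setminus V'$ and the other in $V'\setminus V$.
   Context: A family $I=([\ell_v,r_v])_{v\in V}$ of closed real intervals indexed by a finite set $V$ is regarded as an interval graph on vertex set $V$ in which $u,v$ are adjacent iff their intervals intersect; it is assumed that all endpoints are distinct (no two intervals share an endpoint and $\ell_v\neq r_v$). Two interval graphs $I=([\ell_v,r_v])_{v\in V}$ and $I'=([\ell'_v,r'_v])_{v\in V'}$ are consistent if for all $u,v\in V\cap V'$: $\ell_u\le\ell_v\Leftrightarrow\ell'_u\le\ell'_v$; $r_u\le r_v\Leftrightarrow r'_u\le r'_v$; $\ell_u\le r_v\Leftrightarrow \ell'_u\le r'_v$; and $r_u\le\ell_v\Leftrightarrow r'_u\le\ell'_v$.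
   Formalization: The intervals of I, I′ and of the interval graph J have rational endpoints rather than real ones. -}

module Defs where

open import Data.Nat using (ℕ)
open import Data.Fin using (Fin)
open import Data.Fin.Subset using (Subset; _∈_; _∉_; _∪_)
open import Data.Rational using (ℚ; _≤_; _<_)
open import Data.Product using (_×_)
open import Function.Bundles using (_⇔_)
open import Relation.Binary.PropositionalEquality using (_≡_; _≢_)

-- Vertices live in the ambient finite type Fin n; an interval graph has a
-- vertex set V ⊆ Fin n and assigns to each v ∈ V the closed interval
-- [ℓ v , r v] (values of ℓ, r outside V are irrelevant).
-- Endpoints are rationals (stand-in for reals).
record IntervalGraph (n : ℕ) : Set where
  field
    V : Subset n
    ℓ : Fin n → ℚ
    r : Fin n → ℚ
    nondeg : ∀ v → v ∈ V → ℓ v < r v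
    distinct : ∀ u v → u ∈ V → v ∈ V → u ≢ v →
               (ℓ u ≢ ℓ v) × (r u ≢ r v) × (ℓ u ≢ r v)

open IntervalGraph public

Consistent : ∀ {n} → IntervalGraph n → IntervalGraph n → Set
Consistent I I' = ∀ u v → u ∈ V I → v ∈ V I → u ∈ V I' → v ∈ V I' →
    ((ℓ I u ≤ ℓ I v) ⇔ (ℓ I' u ≤ ℓ I' v))
  × ((r I u ≤ r I v) ⇔ (r I' u ≤ r I' v))
  × ((ℓ I u ≤ r I v) ⇔ (ℓ I' u ≤ r I' v))
  × ((r I u ≤ ℓ I v) ⇔ (r I' u ≤ ℓ I' v))

Edge : ∀ {n} → IntervalGraph n → Fin n → Fin n → Set
Edge I u v = (u ≢ v) × (u ∈ V I) × (v ∈ V I)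
           × (ℓ I u ≤ r I v) × (ℓ I v ≤ r I u)

module Submission where

-- Endpoints of vertices lying in both graphs appear in the same relative order in I and I', so the
-- number of them weakly below such an endpoint (its level) is the same in I and in I'. Vertices of I
-- take their endpoints from I (tier 0), the remaining ones from I' (tier 1), and J orders endpoints
-- lexicographically by (level, tier, position in the own graph). Within one graph this key is
-- strictly increasing; between a shared vertex and a vertex of I' \ I the levels already order the
-- endpoints as I' does, the tier breaking ties. So J is consistent with I and I', and an edge of J
-- between two vertices of the same graph is an edge of that graph.

open import Defs
open import Data.Nat using (ℕ)
open import Data.Fin.Subset using (_∈_; _∉_; _∪_)
open import Data.Product using (Σ; _×_)
open import Data.Sum using (_⊎_)
open import Relation.Nullary using (¬_)
open import Relation.Binary.PropositionalEquality using (_≡_)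

import Data.Nat as ℕ
import Data.Nat.Properties as ℕ
import Data.Integer as ℤ
import Data.Integer.Properties as ℤ
open import Data.Fin as Fin using (Fin)
open import Data.Fin.Subset.Properties using (_∈?_; x∈p∪q⁻)
open import Data.Rational using (ℚ; _≤_; _<_; _≤?_; *<*)
open import Data.Rational.Literals using (fromℤ)
open import Data.Rational.Properties
  using (≤-refl; ≤-reflexive; ≤-trans; <⇒≤; <⇒≢; ≰⇒>; <-≤-trans; <-cmp)
open import Data.List using (List; []; _∷_; filter; length; allFin; cartesianProduct)
open import Data.List.Properties using (length-filter)
open import Data.List.Membership.Propositional using () renaming (_∈_ to _∈ˡ_)
open import Data.List.Membership.Propositional.Properties
  using (∈-filter⁺; ∈-filter⁻; ∈-allFin; ∈-cartesianProduct⁺)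
open import Data.List.Relation.Unary.Any using (here; there)
open import Data.Product using (_,_; proj₁; proj₂)
open import Data.Sum using (inj₁; inj₂)
open import Relation.Nullary using (Dec; yes; no; contradiction)
open import Relation.Nullary.Decidable using (_×-dec_)
open import Relation.Binary.PropositionalEquality using (_≢_; refl; sym; cong; subst; subst₂)
open import Relation.Binary.Definitions using (tri<; tri≈; tri>)
open import Function using (_∘_)
open import Relation.Unary using (Pred; Decidable; _⊆_)
open import Function.Bundles using (_⇔_; mk⇔; Equivalence)
open Equivalence using (to; from)

<⇒≱ : ∀ {x y : ℚ} → x < y → ¬ (y ≤ x)
<⇒≱ x<y y≤x = <⇒≢ (<-≤-trans x<y y≤x) refl

≤⇔≤-if-<-preserved : ∀ {x y p q : ℚ} → (x ≡ y → p ≡ q) → (x < y → p < q) → (y < x → q < p) →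
  (p ≤ q) ⇔ (x ≤ y)
≤⇔≤-if-<-preserved {x} {y} ≡-pres <-pres >-pres = mk⇔ reflect preserve
  where
  reflect : _ → x ≤ y
  reflect p≤q with x ≤? y
  ... | yes x≤y = x≤y
  ... | no  x≰y = contradiction p≤q (<⇒≱ (>-pres (≰⇒> x≰y)))
  preserve : x ≤ y → _
  preserve x≤y with <-cmp x y
  ... | tri< x<y _ _ = <⇒≤ (<-pres x<y)
  ... | tri≈ _ x≡y _ = ≤-reflexive (≡-pres x≡y)
  ... | tri> _ _ y<x = contradiction x≤y (<⇒≱ y<x)

≢-if-<-preserved : ∀ {x y : ℚ} {m m' : ℕ} → (x < y → m ℕ.< m') → (y < x → m' ℕ.< m) →
  x ≢ y → m ≢ m'
≢-if-<-preserved {x} {y} <-pres >-pres x≢y with <-cmp x y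
... | tri< x<y _ _ = ℕ.<⇒≢ (<-pres x<y)
... | tri≈ _ x≡y _ = contradiction x≡y x≢y
... | tri> _ _ y<x = ℕ.<⇒≢ (>-pres y<x) ∘ sym

toℚ : ℕ → ℚ
toℚ m = fromℤ (ℤ.+ m)

toℚ-< : ∀ {m m'} → m ℕ.< m' → toℚ m < toℚ m'
toℚ-< {m} {m'} m<m' =
  *<* (subst₂ ℤ._<_ (sym (ℤ.*-identityʳ (ℤ.+ m))) (sym (ℤ.*-identityʳ (ℤ.+ m'))) (ℤ.+<+ m<m'))

toℚ-injective : ∀ {m m'} → toℚ m ≡ toℚ m' → m ≡ m'
toℚ-injective eq = ℤ.+-injective (cong ℚ.numerator eq)

*+-<-by-first : ∀ {a c b d M} → b ℕ.< M → a ℕ.< c → a ℕ.* M ℕ.+ b ℕ.< c ℕ.* M ℕ.+ d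
*+-<-by-first {a} {c} {b} {d} {M} b<M a<c = begin-strict
  a ℕ.* M ℕ.+ b  <⟨ ℕ.+-monoʳ-< (a ℕ.* M) b<M ⟩
  a ℕ.* M ℕ.+ M  ≡⟨ ℕ.+-comm (a ℕ.* M) M ⟩
  ℕ.suc a ℕ.* M  ≤⟨ ℕ.*-monoˡ-≤ M a<c ⟩
  c ℕ.* M        ≤⟨ ℕ.m≤m+n (c ℕ.* M) d ⟩
  c ℕ.* M ℕ.+ d  ∎
  where open ℕ.≤-Reasoning

*+-<-by-second : ∀ {a c b d M} → a ℕ.≤ c → b ℕ.< d → a ℕ.* M ℕ.+ b ℕ.< c ℕ.* M ℕ.+ d
*+-<-by-second {M = M} a≤c b<d = ℕ.+-mono-≤-< (ℕ.*-monoˡ-≤ M a≤c) b<d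

*+-≢ : ∀ {a c b d M} → b ℕ.< M → d ℕ.< M → a ≢ c → a ℕ.* M ℕ.+ b ≢ c ℕ.* M ℕ.+ d
*+-≢ {a} {c} b<M d<M a≢c with ℕ.<-cmp a c
... | tri< a<c _ _ = ℕ.<⇒≢ (*+-<-by-first b<M a<c)
... | tri≈ _ a≡c _ = contradiction a≡c a≢c
... | tri> _ _ c<a = ℕ.<⇒≢ (*+-<-by-first d<M c<a) ∘ sym

module _ {A : Set} {p q} {P : Pred A p} {Q : Pred A q} (P? : Decidable P) (Q? : Decidable Q) where

  length-filter-mono : P ⊆ Q → ∀ xs → length (filter P? xs) ℕ.≤ length (filter Q? xs)
  length-filter-mono P⊆Q []       = ℕ.z≤n
  length-filter-mono P⊆Q (x ∷ xs) with P? x | Q? x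
  ... | yes _  | yes _  = ℕ.s≤s (length-filter-mono P⊆Q xs)
  ... | yes Px | no ¬Qx = contradiction (P⊆Q Px) ¬Qx
  ... | no _   | yes _  = ℕ.m≤n⇒m≤1+n (length-filter-mono P⊆Q xs)
  ... | no _   | no _   = length-filter-mono P⊆Q xs

  length-filter-< : P ⊆ Q → ∀ {z xs} → z ∈ˡ xs → ¬ P z → Q z →
    length (filter P? xs) ℕ.< length (filter Q? xs)
  length-filter-< P⊆Q {z} {z ∷ xs} (here refl) ¬Pz Qz with P? z | Q? z
  ... | yes Pz | _      = contradiction Pz ¬Pz
  ... | no _   | yes _  = ℕ.s≤s (length-filter-mono P⊆Q xs)
  ... | no _   | no ¬Qz = contradiction Qz ¬Qz
  length-filter-< P⊆Q {z} {x ∷ xs} (there z∈xs) ¬Pz Qz with P? x | Q? x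
  ... | yes _  | yes _  = ℕ.s≤s (length-filter-< P⊆Q z∈xs ¬Pz Qz)
  ... | yes Px | no ¬Qx = contradiction (P⊆Q Px) ¬Qx
  ... | no _   | yes _  = ℕ.m<n⇒m<1+n (length-filter-< P⊆Q z∈xs ¬Pz Qz)
  ... | no _   | no _   = length-filter-< P⊆Q z∈xs ¬Pz Qz

  length-filter-cong : ∀ xs → (∀ {x} → x ∈ˡ xs → P x ⇔ Q x) →
    length (filter P? xs) ≡ length (filter Q? xs)
  length-filter-cong []       P⇔Q = refl
  length-filter-cong (x ∷ xs) P⇔Q with P? x | Q? x
  ... | yes _  | yes _  = cong ℕ.suc (length-filter-cong xs (P⇔Q ∘ there))
  ... | yes Px | no ¬Qx = contradiction (to (P⇔Q (here refl)) Px) ¬Qx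
  ... | no ¬Px | yes Qx = contradiction (from (P⇔Q (here refl)) Qx) ¬Px
  ... | no _   | no _   = length-filter-cong xs (P⇔Q ∘ there)

data Side : Set where
  left right : Side

Key : ℕ → Set
Key n = Fin n × Side

vertex : ∀ {n} → Key n → Fin n
vertex = proj₁

endpoint : ∀ {n} → IntervalGraph n → Key n → ℚ
endpoint G (v , left)  = ℓ G v
endpoint G (v , right) = r G v

endpoint-≢ : ∀ {n} (G : IntervalGraph n) {u v} → u ∈ V G → v ∈ V G → u ≢ v →
  ∀ a b → endpoint G (u , a) ≢ endpoint G (v , b)
endpoint-≢ G uG vG u≢v left  left  = proj₁ (distinct G _ _ uG vG u≢v)
endpoint-≢ G uG vG u≢v right right = proj₁ (proj₂ (distinct G _ _ uG vG u≢v))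
endpoint-≢ G uG vG u≢v left  right = proj₂ (proj₂ (distinct G _ _ uG vG u≢v))
endpoint-≢ G uG vG u≢v right left  = proj₂ (proj₂ (distinct G _ _ vG uG (u≢v ∘ sym))) ∘ sym

endpoint-injective : ∀ {n} (G : IntervalGraph n) {k k' : Key n} →
  vertex k ∈ V G → vertex k' ∈ V G → endpoint G k ≡ endpoint G k' → k ≡ k'
endpoint-injective G {u , a} {v , b} uG vG eq with u Fin.≟ v
endpoint-injective G {u , a}     {v , b}      uG vG eq | no u≢v   = contradiction eq (endpoint-≢ G uG vG u≢v a b)
endpoint-injective G {u , left}  {.u , left}  uG vG eq | yes refl = refl
endpoint-injective G {u , right} {.u , right} uG vG eq | yes refl = refl
endpoint-injective G {u , left}  {.u , right} uG vG eq | yes refl = contradiction eq (<⇒≢ (nondeg G u uG))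
endpoint-injective G {u , right} {.u , left}  uG vG eq | yes refl = contradiction eq (<⇒≢ (nondeg G u uG) ∘ sym)

Consistent⇒endpoint-≤⇔ : ∀ {n} (G H : IntervalGraph n) → Consistent G H → ∀ {k k'} →
  vertex k ∈ V G → vertex k' ∈ V G → vertex k ∈ V H → vertex k' ∈ V H →
  (endpoint G k ≤ endpoint G k') ⇔ (endpoint H k ≤ endpoint H k')
Consistent⇒endpoint-≤⇔ G H c {u , left}  {v , left}  uG vG uH vH =
  proj₁ (c u v uG vG uH vH)
Consistent⇒endpoint-≤⇔ G H c {u , right} {v , right} uG vG uH vH =
  proj₁ (proj₂ (c u v uG vG uH vH))
Consistent⇒endpoint-≤⇔ G H c {u , left}  {v , right} uG vG uH vH =
  proj₁ (proj₂ (proj₂ (c u v uG vG uH vH)))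
Consistent⇒endpoint-≤⇔ G H c {u , right} {v , left}  uG vG uH vH =
  proj₂ (proj₂ (proj₂ (c u v uG vG uH vH)))

Consistent⇐endpoint-≤⇔ : ∀ {n} {G H : IntervalGraph n} →
  (∀ {k k'} → vertex k ∈ V G → vertex k' ∈ V G → vertex k ∈ V H → vertex k' ∈ V H →
     (endpoint G k ≤ endpoint G k') ⇔ (endpoint H k ≤ endpoint H k')) →
  Consistent G H
Consistent⇐endpoint-≤⇔ c u v uG vG uH vH =
    c {u , left}  {v , left}  uG vG uH vH
  , c {u , right} {v , right} uG vG uH vH
  , c {u , left}  {v , right} uG vG uH vH
  , c {u , right} {v , left}  uG vG uH vH

Consistent⇒endpoint-< : ∀ {n} (G H : IntervalGraph n) → Consistent G H → ∀ {k k'} →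
  vertex k ∈ V G → vertex k' ∈ V G → vertex k ∈ V H → vertex k' ∈ V H →
  endpoint H k < endpoint H k' → endpoint G k < endpoint G k'
Consistent⇒endpoint-< G H c {k} {k'} kG k'G kH k'H lt =
  ≰⇒> (λ le → <⇒≱ lt (to (Consistent⇒endpoint-≤⇔ G H c {k'} {k} k'G kG k'H kH) le))

Consistent⇒Edge : ∀ {n} (G H : IntervalGraph n) → Consistent G H → ∀ {u v} →
  u ∈ V H → v ∈ V H → Edge G u v → Edge H u v
Consistent⇒Edge G H c {u} {v} uH vH (u≢v , uG , vG , ℓu≤rv , ℓv≤ru) =
    u≢v , uH , vH
  , to (proj₁ (proj₂ (proj₂ (c u v uG vG uH vH)))) ℓu≤rv
  , to (proj₁ (proj₂ (proj₂ (c v u vG uG vH uH)))) ℓv≤ru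

Consistent-new-edge : ∀ {n} (I I' J : IntervalGraph n) →
  (∀ {w} → w ∈ V J → w ∈ V I ⊎ w ∈ V I') → Consistent J I → Consistent J I' →
  ∀ u v → Edge J u v → ¬ Edge I u v → ¬ Edge I' u v →
    ((u ∈ V I) × (u ∉ V I') × (v ∈ V I') × (v ∉ V I))
  ⊎ ((v ∈ V I) × (v ∉ V I') × (u ∈ V I') × (u ∉ V I))
Consistent-new-edge I I' J V-J J≈I J≈I' u v uv@(_ , uJ , vJ , _) ¬I ¬I' with V-J uJ | V-J vJ
... | inj₁ uI  | inj₁ vI  = contradiction (Consistent⇒Edge J I J≈I uI vI uv) ¬I
... | inj₂ uI' | inj₂ vI' = contradiction (Consistent⇒Edge J I' J≈I' uI' vI' uv) ¬I'
... | inj₁ uI  | inj₂ vI' = inj₁ (uI , (λ uI' → ¬I' (Consistent⇒Edge J I' J≈I' uI' vI' uv))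
                               , vI' , (λ vI → ¬I (Consistent⇒Edge J I J≈I uI vI uv)))
... | inj₂ uI' | inj₁ vI  = inj₂ (vI , (λ vI' → ¬I' (Consistent⇒Edge J I' J≈I' uI' vI' uv))
                               , uI' , (λ uI → ¬I (Consistent⇒Edge J I J≈I uI vI uv)))

rank : ∀ {n} → List (Key n) → IntervalGraph n → ℚ → ℕ
rank ks G x = length (filter (λ k → endpoint G k ≤? x) ks)

rank-mono : ∀ {n} ks (G : IntervalGraph n) {x y} → x ≤ y → rank ks G x ℕ.≤ rank ks G y
rank-mono ks G {x} {y} x≤y =
  length-filter-mono (λ k → endpoint G k ≤? x) (λ k → endpoint G k ≤? y) (λ le → ≤-trans le x≤y) ks

rank-< : ∀ {n} {ks} (G : IntervalGraph n) {k y} → k ∈ˡ ks → y < endpoint G k →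
  rank ks G y ℕ.< rank ks G (endpoint G k)
rank-< G {k} {y} k∈ks y<k =
  length-filter-< (λ k → endpoint G k ≤? y) (λ k' → endpoint G k' ≤? endpoint G k)
    (λ le → ≤-trans le (<⇒≤ y<k)) k∈ks (<⇒≱ y<k) ≤-refl

even<odd : ∀ {a b} → a ℕ.≤ b → 2 ℕ.* a ℕ.< ℕ.suc (2 ℕ.* b)
even<odd a≤b = ℕ.s≤s (ℕ.*-monoʳ-≤ 2 a≤b)

odd<even : ∀ {a b} → a ℕ.< b → ℕ.suc (2 ℕ.* a) ℕ.< 2 ℕ.* b
odd<even {a} {b} a<b = subst (ℕ._≤ 2 ℕ.* b) (ℕ.*-suc 2 a) (ℕ.*-monoʳ-≤ 2 a<b)

module Amalgamation {n} (I I' : IntervalGraph n) (I≈I' : Consistent I I') where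

  Shared : Fin n → Set
  Shared v = v ∈ V I × v ∈ V I'

  allKeys : List (Key n)
  allKeys = cartesianProduct (allFin n) (left ∷ right ∷ [])

  ∈-allKeys : ∀ k → k ∈ˡ allKeys
  ∈-allKeys (v , left)  = ∈-cartesianProduct⁺ (∈-allFin v) (here refl)
  ∈-allKeys (v , right) = ∈-cartesianProduct⁺ (∈-allFin v) (there (here refl))

  shared? : Decidable (Shared ∘ vertex)
  shared? k = (vertex k ∈? V I) ×-dec (vertex k ∈? V I')

  sharedKeys : List (Key n)
  sharedKeys = filter shared? allKeys

  level : IntervalGraph n → Key n → ℕ
  level G k = rank sharedKeys G (endpoint G k)

  level-shared : ∀ {k} → Shared (vertex k) → level I k ≡ level I' k
  level-shared {k} (kI , kI') =
    length-filter-cong (λ k' → endpoint I k' ≤? endpoint I k) (λ k' → endpoint I' k' ≤? endpoint I' k)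
                       sharedKeys same-side
    where
    same-side : ∀ {k'} → k' ∈ˡ sharedKeys →
      (endpoint I k' ≤ endpoint I k) ⇔ (endpoint I' k' ≤ endpoint I' k)
    same-side {k'} k'∈ with proj₂ (∈-filter⁻ shared? {xs = allKeys} k'∈)
    ... | k'I , k'I' = Consistent⇒endpoint-≤⇔ I I' I≈I' {k'} {k} k'I kI k'I' kI'

  level-mono : ∀ G {k k'} → endpoint G k ≤ endpoint G k' → level G k ℕ.≤ level G k'
  level-mono G k≤k' = rank-mono sharedKeys G k≤k'

  level-< : ∀ G {k k'} → Shared (vertex k') → endpoint G k < endpoint G k' → level G k ℕ.< level G k'
  level-< G {k' = k'} shared k<k' = rank-< G (∈-filter⁺ shared? (∈-allKeys k') shared) k<k'

  offset : IntervalGraph n → Key n → ℕ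
  offset G k = rank allKeys G (endpoint G k)

  width : ℕ
  width = ℕ.suc (length allKeys)

  offset<width : ∀ G k → offset G k ℕ.< width
  offset<width G k = ℕ.s≤s (length-filter _ allKeys)

  -- encodes the key (level, tier, offset) lexicographically, for tier ≤ 1 and offset < width
  slot : IntervalGraph n → ℕ → Key n → ℕ
  slot G tier k = (tier ℕ.+ 2 ℕ.* level G k) ℕ.* width ℕ.+ offset G k

  slot-< : ∀ G tier {k k'} → endpoint G k < endpoint G k' → slot G tier k ℕ.< slot G tier k'
  slot-< G tier {k} {k'} k<k' =
    *+-<-by-second (ℕ.+-monoʳ-≤ tier (ℕ.*-monoʳ-≤ 2 (level-mono G {k} {k'} (<⇒≤ k<k'))))
                   (rank-< G (∈-allKeys k') k<k')

  position : Key n → ℕ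
  position k with vertex k ∈? V I
  ... | yes _ = slot I 0 k
  ... | no  _ = slot I' 1 k

  position-∈ : ∀ {k} → vertex k ∈ V I → position k ≡ slot I 0 k
  position-∈ {k} kI with vertex k ∈? V I
  ... | yes _  = refl
  ... | no ¬kI = contradiction kI ¬kI

  position-∉ : ∀ {k} → vertex k ∉ V I → position k ≡ slot I' 1 k
  position-∉ {k} ¬kI with vertex k ∈? V I
  ... | yes kI = contradiction kI ¬kI
  ... | no _   = refl

  Preserves< : IntervalGraph n → Set
  Preserves< H = ∀ {k k'} → vertex k ∈ V H → vertex k' ∈ V H →
    endpoint H k < endpoint H k' → position k ℕ.< position k'

  position-preserves<-I : Preserves< I
  position-preserves<-I {k} {k'} kI k'I k<k' rewrite position-∈ {k} kI | position-∈ {k'} k'I =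
    slot-< I 0 {k} {k'} k<k'

  position-preserves<-I' : Preserves< I'
  position-preserves<-I' {k} {k'} kI' k'I' k<k' with vertex k ∈? V I | vertex k' ∈? V I
  ... | yes kI | yes k'I rewrite position-∈ {k} kI | position-∈ {k'} k'I =
    slot-< I 0 {k} {k'} (Consistent⇒endpoint-< I I' I≈I' {k} {k'} kI k'I kI' k'I' k<k')
  ... | no ¬kI | no ¬k'I rewrite position-∉ {k} ¬kI | position-∉ {k'} ¬k'I =
    slot-< I' 1 {k} {k'} k<k'
  ... | yes kI | no ¬k'I rewrite position-∈ {k} kI | position-∉ {k'} ¬k'I =
    *+-<-by-first (offset<width I k)
      (even<odd (subst (ℕ._≤ level I' k') (sym (level-shared {k} (kI , kI')))
                       (level-mono I' {k} {k'} (<⇒≤ k<k'))))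
  ... | no ¬kI | yes k'I rewrite position-∉ {k} ¬kI | position-∈ {k'} k'I =
    *+-<-by-first (offset<width I' k)
      (odd<even (subst (level I' k ℕ.<_) (sym (level-shared {k'} (k'I , k'I')))
                       (level-< I' {k} {k'} (k'I , k'I') k<k')))

  position-≢-within : ∀ H → Preserves< H → ∀ {u v a b} → u ∈ V H → v ∈ V H → u ≢ v →
    position (u , a) ≢ position (v , b)
  position-≢-within H pres {u} {v} {a} {b} uH vH u≢v =
    ≢-if-<-preserved (pres {u , a} {v , b} uH vH) (pres {v , b} {u , a} vH uH)
                     (endpoint-≢ H uH vH u≢v a b)

  position-≢-across : ∀ {u v a b} → u ∈ V I → v ∈ V I' → u ≢ v → position (u , a) ≢ position (v , b)
  position-≢-across {u} {v} {a} {b} uI vI' u≢v = by-cases (u ∈? V I') (v ∈? V I)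
    where
    by-cases : Dec (u ∈ V I') → Dec (v ∈ V I) → position (u , a) ≢ position (v , b)
    by-cases (yes uI') _        = position-≢-within I' position-preserves<-I' uI' vI' u≢v
    by-cases (no _)    (yes vI) = position-≢-within I position-preserves<-I uI vI u≢v
    by-cases (no _)    (no ¬vI) rewrite position-∈ {u , a} uI | position-∉ {v , b} ¬vI =
      *+-≢ (offset<width I (u , a)) (offset<width I' (v , b))
           (ℕ.even≢odd (level I (u , a)) (level I' (v , b)))

  position-≢ : ∀ {u v a b} → u ∈ V I ∪ V I' → v ∈ V I ∪ V I' → u ≢ v →
    position (u , a) ≢ position (v , b)
  position-≢ {u} {v} uJ vJ u≢v with x∈p∪q⁻ (V I) (V I') uJ | x∈p∪q⁻ (V I) (V I') vJ
  ... | inj₁ uI  | inj₁ vI  = position-≢-within I position-preserves<-I uI vI u≢v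
  ... | inj₂ uI' | inj₂ vI' = position-≢-within I' position-preserves<-I' uI' vI' u≢v
  ... | inj₁ uI  | inj₂ vI' = position-≢-across uI vI' u≢v
  ... | inj₂ uI' | inj₁ vI  = position-≢-across vI uI' (u≢v ∘ sym) ∘ sym

  position-left<right : ∀ {v} → v ∈ V I ∪ V I' → position (v , left) ℕ.< position (v , right)
  position-left<right {v} vJ with x∈p∪q⁻ (V I) (V I') vJ
  ... | inj₁ vI  = position-preserves<-I vI vI (nondeg I v vI)
  ... | inj₂ vI' = position-preserves<-I' vI' vI' (nondeg I' v vI')

  J : IntervalGraph n
  J = record
    { V        = V I ∪ V I'
    ; ℓ        = λ v → toℚ (position (v , left))
    ; r        = λ v → toℚ (position (v , right))
    ; nondeg   = λ v vJ → toℚ-< (position-left<right vJ)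
    ; distinct = λ u v uJ vJ u≢v →
          position-≢ uJ vJ u≢v ∘ toℚ-injective
        , position-≢ uJ vJ u≢v ∘ toℚ-injective
        , position-≢ uJ vJ u≢v ∘ toℚ-injective
    }

  endpoint-J : ∀ k → endpoint J k ≡ toℚ (position k)
  endpoint-J (v , left)  = refl
  endpoint-J (v , right) = refl

  J-consistent : ∀ H → Preserves< H → Consistent J H
  J-consistent H pres = Consistent⇐endpoint-≤⇔ λ {k} {k'} _ _ kH k'H →
    ≤⇔≤-if-<-preserved
      (λ eq → cong (endpoint J) (endpoint-injective H {k} {k'} kH k'H eq))
      (λ k<k' → subst₂ _<_ (sym (endpoint-J k)) (sym (endpoint-J k'))
                           (toℚ-< (pres {k} {k'} kH k'H k<k')))
      (λ k'<k → subst₂ _<_ (sym (endpoint-J k')) (sym (endpoint-J k))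
                           (toℚ-< (pres {k'} {k} k'H kH k'<k)))

lemma5 : ∀ (n : ℕ) (I I' : IntervalGraph n) → Consistent I I' →
  Σ (IntervalGraph n) (λ J →
      (V J ≡ V I ∪ V I')
    × Consistent J I
    × Consistent J I'
    × (∀ u v → Edge J u v → ¬ Edge I u v → ¬ Edge I' u v →
         ((u ∈ V I) × (u ∉ V I') × (v ∈ V I') × (v ∉ V I))
       ⊎ ((v ∈ V I) × (v ∉ V I') × (u ∈ V I') × (u ∉ V I))))
lemma5 n I I' I≈I' =
  J , refl , J≈I , J≈I' , Consistent-new-edge I I' J (x∈p∪q⁻ (V I) (V I')) J≈I J≈I'
  where
  open Amalgamation I I' I≈I'
  J≈I : Consistent J I
  J≈I = J-consistent I position-preserves<-I

  J≈I' : Consistent J I'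
  J≈I' = J-consistent I' position-preserves<-I'
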